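{- In XCCS-PDL the rule (PCSub) is sound: if $\Vdash \langle P\rangle p\leftrightarrow\langle Q\rangle p$, then $\Vdash\langle P|R\rangle p\leftrightarrow\langle Q|R\rangle p$.
   Context: XCCS-PDL formulas: $\varphi ::= p\mid\top\mid\neg\varphi\mid\varphi_1\land\varphi_2\mid\langle\alpha\rangle\varphi\mid\langle P\rangle\varphi$, with XCCS processes $P ::= {\bf 0}\mid END\mid\alpha.P\mid P_1;P_2\mid P_1+P_2\mid P_1|P_2\mid P^*\mid P\backslash L$ (running actions $\alpha ::= a\mid\overline a\mid\tau$; successful termination $\mathrm{Done}$ only via the ending action $END$). $\overrightarrow{{\cal R}_f}(P)=\{\overrightarrow{\alpha}:P\stackrel{\overrightarrow{\alpha}}{\Rightarrow}\mathrm{Done}\}$ under the XCCS transition rules. Frames $(W,\{R_\alpha\},R_{END})$ with $R_{END}$ the identity on $W$; ${\cal M},w\Vdash\langle P\rangle\varphi$ iff there is a path $(v_0,\ldots,v_n)$, $n\ge1$, $v_0=w$, ${\cal M},v_n\Vdash\varphi$, and $\overrightarrow{\alpha}\in\overrightarrow{{\cal R}_f}(P)$ of length $n$ with $(v_{i-1},v_i)\in R_\beta$ iff $(\overrightarrow{\alpha})_i=\beta$. $\Vdash$ = validity over all models. Known facts: $\overrightarrow{{\cal R}_f}(P)=\overrightarrow{{\cal R}_f}(Q)$ iff $\Vdash\langle P\rangle p\leftrightarrow\langle Q\rangle p$; and $\overrightarrow{{\cal R}_f}(P_1|P_2)=\bigcup\{\overrightarrow{{\cal R}_f}(\overrightarrow{\alpha}|\overrightarrow{\beta}):\overrightarrow{\alpha}\in\overrightarrow{{\cal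 R}_f}(P_1),\overrightarrow{\beta}\in\overrightarrow{{\cal R}_f}(P_2)\}$. -}

module Defs where

open import Data.Nat using (ℕ; _≤_)
open import Data.List using (List; []; _∷_; length)
open import Data.List.Membership.Propositional using (_∈_)
open import Data.Product using (Σ; ∃; _×_; _,_)
open import Data.Unit using () renaming (⊤ to Unit)
open import Relation.Nullary using (¬_)
open import Relation.Binary.PropositionalEquality using (_≡_)

Name : Set
Name = ℕ

data Act : Set where
  nm  : Name → Act
  co  : Name → Act
  τ   : Act

data Label : Set where
  run : Act → Label
  end : Label

data Proc : Set where
  𝟎     : Proc
  END   : Proc
  _∙_   : Act → Proc → Proc
  _⨾_   : Proc → Proc → Proc
  _⊕_   : Proc → Proc → Proc
  _∥_   : Proc → Proc → Proc
  _⋆    : Proc → Proc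
  _∖_   : Proc → List Name → Proc

data State : Set where
  proc : Proc → State
  Done : State

data Allowed (L : List Name) : Act → Set where
  τ-ok  : Allowed L τ
  nm-ok : ∀ {a} → ¬ (a ∈ L) → Allowed L (nm a)
  co-ok : ∀ {a} → ¬ (a ∈ L) → Allowed L (co a)

data _—[_]→_ : Proc → Label → State → Set where
  act   : ∀ {α P} → (α ∙ P) —[ run α ]→ proc P
  endR  : END —[ end ]→ Done
  sumL  : ∀ {P Q l s} → P —[ l ]→ s → (P ⊕ Q) —[ l ]→ s
  sumR  : ∀ {P Q l s} → Q —[ l ]→ s → (P ⊕ Q) —[ l ]→ s
  seq₁  : ∀ {P P' Q α} → P —[ run α ]→ proc P' → (P ⨾ Q) —[ run α ]→ proc (P' ⨾ Q)
  seq₂  : ∀ {P Q l s} → P —[ end ]→ Done → Q —[ l ]→ s → (P ⨾ Q) —[ l ]→ s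
  parL  : ∀ {P P' Q α} → P —[ run α ]→ proc P' → (P ∥ Q) —[ run α ]→ proc (P' ∥ Q)
  parR  : ∀ {P Q Q' α} → Q —[ run α ]→ proc Q' → (P ∥ Q) —[ run α ]→ proc (P ∥ Q')
  com₁  : ∀ {P P' Q Q' a} → P —[ run (nm a) ]→ proc P' → Q —[ run (co a) ]→ proc Q'
        → (P ∥ Q) —[ run τ ]→ proc (P' ∥ Q')
  com₂  : ∀ {P P' Q Q' a} → P —[ run (co a) ]→ proc P' → Q —[ run (nm a) ]→ proc Q'
        → (P ∥ Q) —[ run τ ]→ proc (P' ∥ Q')
  parE  : ∀ {P Q} → P —[ end ]→ Done → Q —[ end ]→ Done → (P ∥ Q) —[ end ]→ Done
  starE : ∀ {P} → (P ⋆) —[ end ]→ Done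
  starA : ∀ {P P' α} → P —[ run α ]→ proc P' → (P ⋆) —[ run α ]→ proc (P' ⨾ (P ⋆))
  resA  : ∀ {P P' L α} → Allowed L α → P —[ run α ]→ proc P'
        → (P ∖ L) —[ run α ]→ proc (P' ∖ L)
  resE  : ∀ {P L} → P —[ end ]→ Done → (P ∖ L) —[ end ]→ Done

data _⇒[_]_ : State → List Label → State → Set where
  ε    : ∀ {s} → s ⇒[ [] ] s
  _◅_  : ∀ {P l s t s'} → P —[ l ]→ s → s ⇒[ t ] s' → proc P ⇒[ l ∷ t ] s'

Rf : Proc → List Label → Set
Rf P t = proc P ⇒[ t ] Done

data Form : Set where
  var  : ℕ → Form
  ⊤′   : Form
  ¬′_  : Form → Form
  _∧′_ : Form → Form → Form
  ⟨_⟩ₐ_ : Act → Form → Form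
  ⟨_⟩ₚ_ : Proc → Form → Form

_⇒′_ : Form → Form → Form
φ ⇒′ ψ = ¬′ (φ ∧′ (¬′ ψ))

_⇔′_ : Form → Form → Form
φ ⇔′ ψ = (φ ⇒′ ψ) ∧′ (ψ ⇒′ φ)

-- Models (W, {R_α}, R_END, V) with R_END the identity on W

record Model : Set₁ where
  field
    W : Set
    R : Act → W → W → Set
    V : ℕ → W → Set

open Model public

RL : (M : Model) → Label → W M → W M → Set
RL M (run α) = R M α
RL M end     = _≡_

data Path (M : Model) : W M → List Label → W M → Set where
  here : ∀ {w} → Path M w [] w
  step : ∀ {w u v l t} → RL M l w u → Path M u t v → Path M w (l ∷ t) v

_,_⊩_ : (M : Model) → W M → Form → Set
M , w ⊩ var p    = V M p w
M , w ⊩ ⊤′       = Unit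
M , w ⊩ (¬′ φ)   = ¬ (M , w ⊩ φ)
M , w ⊩ (φ ∧′ ψ) = (M , w ⊩ φ) × (M , w ⊩ ψ)
M , w ⊩ (⟨ α ⟩ₐ φ) = Σ (W M) λ v → R M α w v × (M , v ⊩ φ)
M , w ⊩ (⟨ P ⟩ₚ φ) =
  Σ (List Label) λ t → Σ (W M) λ v →
    Rf P t × (1 ≤ length t) × Path M w t v × (M , v ⊩ φ)

⊩_ : Form → Set₁
⊩ φ = (M : Model) (w : W M) → M , w ⊩ φ

-- Validity of ⟨P⟩p → ⟨Q⟩p forces every successful trace of P to be one of Q:
-- evaluate it in the canonical model whose worlds are action sequences, where
-- R_α strips the head α and p holds only at the empty sequence. Conversely,
-- trace inclusion gives validity of ⟨P⟩φ → ⟨Q⟩φ for every φ. Successful traces of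
-- P | R are exactly the interleavings (with synchronisations) of traces of P and
-- of R, so trace inclusion is preserved by putting both sides in parallel with R.
-- Since → and ↔ are encoded by negation, all inclusions hold up to ¬¬.
module Submission where

open import Defs
open import Data.Nat using (ℕ; _≤_; s≤s; z≤n)
open import Data.List using (List; []; _∷_; [_]; length; map; _++_)
open import Data.List.Properties using (++-identityʳ)
open import Data.Product using (∃; _×_; _,_; proj₁; proj₂)
open import Relation.Nullary using (¬_)
open import Relation.Binary.PropositionalEquality
  using (_≡_; refl; sym; trans; cong; subst)

end-target : ∀ {P s} → P —[ end ]→ s → s ≡ Done
end-target endR        = refl
end-target (sumL st)   = end-target st
end-target (sumR st)   = end-target st
end-target (seq₂ _ st) = end-target st
end-target (parE _ _)  = refl
end-target starE       = refl
end-target (resE _)    = refl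

run-target : ∀ {P α s} → P —[ run α ]→ s → ∃ λ P′ → s ≡ proc P′
run-target act          = _ , refl
run-target (sumL st)    = run-target st
run-target (sumR st)    = run-target st
run-target (seq₁ _)     = _ , refl
run-target (seq₂ _ st)  = run-target st
run-target (parL _)     = _ , refl
run-target (parR _)     = _ , refl
run-target (com₁ _ _)   = _ , refl
run-target (com₂ _ _)   = _ , refl
run-target (starA _)    = _ , refl
run-target (resA _ _)   = _ , refl

Done-⇒-[] : ∀ {t s} → Done ⇒[ t ] s → t ≡ []
Done-⇒-[] ε = refl

Rf-shape : ∀ {P t} → Rf P t → ∃ λ as → t ≡ map run as ++ [ end ]
Rf-shape {t = end ∷ _} (st ◅ rest) with end-target st
... | refl with Done-⇒-[] rest
... | refl = [] , refl
Rf-shape {t = run α ∷ _} (st ◅ rest) with run-target st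
... | _ , refl with Rf-shape rest
... | as , refl = α ∷ as , refl

Rf-nonempty : ∀ {P t} → Rf P t → 1 ≤ length t
Rf-nonempty (_ ◅ _) = s≤s z≤n

runs : List Label → List Act
runs []          = []
runs (run α ∷ t) = α ∷ runs t
runs (end ∷ t)   = runs t

runs-map-run : ∀ as → runs (map run as ++ [ end ]) ≡ as
runs-map-run []       = refl
runs-map-run (α ∷ as) = cong (α ∷_) (runs-map-run as)

Rf-runs-injective : ∀ {P Q t t′} → Rf P t → Rf Q t′ → runs t ≡ runs t′ → t ≡ t′
Rf-runs-injective rp rq eq with Rf-shape rp | Rf-shape rq
... | as , refl | bs , refl =
  cong (λ xs → map run xs ++ [ end ])
       (trans (sym (runs-map-run as)) (trans eq (runs-map-run bs)))

canonical : Model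
canonical = record
  { W = List Act
  ; R = λ α w v → w ≡ α ∷ v
  ; V = λ _ w → w ≡ []
  }

canonical-path : ∀ t → Path canonical (runs t) t []
canonical-path []          = here
canonical-path (run _ ∷ t) = step refl (canonical-path t)
canonical-path (end ∷ t)   = step refl (canonical-path t)

canonical-path-runs : ∀ {w t v} → Path canonical w t v → w ≡ runs t ++ v
canonical-path-runs here                        = refl
canonical-path-runs (step {l = run α} refl path) = cong (α ∷_) (canonical-path-runs path)
canonical-path-runs (step {l = end} refl path)   = canonical-path-runs path

_⊑_ : Proc → Proc → Set
P ⊑ Q = ∀ t → Rf P t → ¬ ¬ Rf Q t

valid⇒⊑ : ∀ {P Q} p → ⊩ ((⟨ P ⟩ₚ var p) ⇒′ (⟨ Q ⟩ₚ var p)) → P ⊑ Q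
valid⇒⊑ {P} {Q} p valid t rp ¬rq =
  valid canonical (runs t) ((t , [] , rp , Rf-nonempty rp , canonical-path t , refl) , ¬⟨Q⟩p)
  where
  ¬⟨Q⟩p : ¬ (canonical , runs t ⊩ (⟨ Q ⟩ₚ var p))
  ¬⟨Q⟩p (t′ , _ , rq , _ , path , refl) =
    ¬rq (subst (Rf Q) (sym (Rf-runs-injective rp rq runs-t≡runs-t′)) rq)
    where
    runs-t≡runs-t′ : runs t ≡ runs t′
    runs-t≡runs-t′ = trans (canonical-path-runs path) (++-identityʳ (runs t′))

⊑⇒valid : ∀ {P Q} φ → P ⊑ Q → ⊩ ((⟨ P ⟩ₚ φ) ⇒′ (⟨ Q ⟩ₚ φ))
⊑⇒valid φ P⊑Q M w ((t , v , rp , nonempty , path , v⊩φ) , ¬⟨Q⟩φ) =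
  P⊑Q t rp (λ rq → ¬⟨Q⟩φ (t , v , rq , nonempty , path , v⊩φ))

data Interleaving : List Label → List Label → List Label → Set where
  ends  : Interleaving [ end ] [ end ] [ end ]
  left  : ∀ {α t₁ t₂ t} → Interleaving t₁ t₂ t → Interleaving (run α ∷ t₁) t₂ (run α ∷ t)
  right : ∀ {α t₁ t₂ t} → Interleaving t₁ t₂ t → Interleaving t₁ (run α ∷ t₂) (run α ∷ t)
  sync  : ∀ {a t₁ t₂ t} → Interleaving t₁ t₂ t
        → Interleaving (run (nm a) ∷ t₁) (run (co a) ∷ t₂) (run τ ∷ t)
  sync′ : ∀ {a t₁ t₂ t} → Interleaving t₁ t₂ t
        → Interleaving (run (co a) ∷ t₁) (run (nm a) ∷ t₂) (run τ ∷ t)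

Rf-∥-split : ∀ {P R t} → Rf (P ∥ R) t
  → ∃ λ t₁ → ∃ λ t₂ → Rf P t₁ × Rf R t₂ × Interleaving t₁ t₂ t
Rf-∥-split (parE e₁ e₂ ◅ ε) = _ , _ , e₁ ◅ ε , e₂ ◅ ε , ends
Rf-∥-split (parL st ◅ rest) with Rf-∥-split rest
... | _ , _ , r₁ , r₂ , i = _ , _ , st ◅ r₁ , r₂ , left i
Rf-∥-split (parR st ◅ rest) with Rf-∥-split rest
... | _ , _ , r₁ , r₂ , i = _ , _ , r₁ , st ◅ r₂ , right i
Rf-∥-split (com₁ st₁ st₂ ◅ rest) with Rf-∥-split rest
... | _ , _ , r₁ , r₂ , i = _ , _ , st₁ ◅ r₁ , st₂ ◅ r₂ , sync i
Rf-∥-split (com₂ st₁ st₂ ◅ rest) with Rf-∥-split rest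
... | _ , _ , r₁ , r₂ , i = _ , _ , st₁ ◅ r₁ , st₂ ◅ r₂ , sync′ i

Rf-∥-merge : ∀ {P R t₁ t₂ t} → Interleaving t₁ t₂ t → Rf P t₁ → Rf R t₂ → Rf (P ∥ R) t
Rf-∥-merge ends (e₁ ◅ ε) (e₂ ◅ ε) = parE e₁ e₂ ◅ ε
Rf-∥-merge (left i) (st ◅ r₁) r₂ with run-target st
... | _ , refl = parL st ◅ Rf-∥-merge i r₁ r₂
Rf-∥-merge (right i) r₁ (st ◅ r₂) with run-target st
... | _ , refl = parR st ◅ Rf-∥-merge i r₁ r₂
Rf-∥-merge (sync i) (st₁ ◅ r₁) (st₂ ◅ r₂) with run-target st₁ | run-target st₂
... | _ , refl | _ , refl = com₁ st₁ st₂ ◅ Rf-∥-merge i r₁ r₂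
Rf-∥-merge (sync′ i) (st₁ ◅ r₁) (st₂ ◅ r₂) with run-target st₁ | run-target st₂
... | _ , refl | _ , refl = com₂ st₁ st₂ ◅ Rf-∥-merge i r₁ r₂

∥-monoˡ-⊑ : ∀ {P Q} R → P ⊑ Q → (P ∥ R) ⊑ (Q ∥ R)
∥-monoˡ-⊑ R P⊑Q t r with Rf-∥-split r
... | t₁ , _ , r₁ , r₂ , i = λ ¬rq → P⊑Q t₁ r₁ (λ q₁ → ¬rq (Rf-∥-merge i q₁ r₂))

theorem5p15 : (P Q R : Proc) (p : ℕ)
    → ⊩ ((⟨ P ⟩ₚ var p) ⇔′ (⟨ Q ⟩ₚ var p))
    → ⊩ ((⟨ P ∥ R ⟩ₚ var p) ⇔′ (⟨ Q ∥ R ⟩ₚ var p))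
theorem5p15 P Q R p P⇔Q M w =
  ⊑⇒valid (var p) (∥-monoˡ-⊑ R P⊑Q) M w , ⊑⇒valid (var p) (∥-monoˡ-⊑ R Q⊑P) M w
  where
  P⊑Q : P ⊑ Q
  P⊑Q = valid⇒⊑ p (λ M w → proj₁ (P⇔Q M w))
  Q⊑P : Q ⊑ P
  Q⊑P = valid⇒⊑ p (λ M w → proj₂ (P⇔Q M w))
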